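{- Let $D$ be a finite digraph and let $T$ be a spanning arborescence of $D$. Then $T$ is normal in $D$ if and only if $T$ is a depth-first search tree of $D$.
   Context: An arborescence is a rooted oriented tree $T$ containing a directed path from the root to every vertex. We write $v\le_T w$ if $T$ has a directed path from $v$ to $w$, and $\lfloor v\rfloor_T=\{w: v\le_T w\}$. A $T$-path is a non-trivial directed path in $D$ meeting $T$ exactly in its endvertices. The normal assistant of $T$ in $D$ is obtained from $T$ by adding an edge $vw$ for every two $\le_T$-incomparable $v,w\in V(T)$ for which $D$ has a $T$-path from $\lfloor v\rfloor_T$ to $\lfloor w\rfloor_T$. $T$ is normal in $D$ if its normal assistant is acyclic. Depth-first search from a root $r$ proceeds as follows. Start at $r$. At the current vertex $x$, if some edge $xy$ of $D$ leads to a vertex $y$ not yet visited, move along one such edge to $y$. Otherwise, backtrack to the vertex from which $x$ was first reached. Stop when backtracking from $r$. A depth-first search tree is the arborescence formed by the edges along which new vertices were first reached in some run of this algorithm. -}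

module Defs where

open import Data.Nat using (ℕ)
open import Data.Fin using (Fin)
open import Data.Bool using (Bool; true)
open import Data.List using (List; []; _∷_)
open import Data.List.Membership.Propositional using (_∈_; _∉_)
open import Data.List.Relation.Unary.All using (All)
open import Data.List.Relation.Unary.Unique.Propositional using (Unique)
open import Data.Product using (Σ; ∃; ∃-syntax; _×_; _,_)
open import Data.Empty using (⊥)
open import Relation.Nullary using (¬_)
open import Relation.Binary.PropositionalEquality using (_≡_; _≢_)
open import Relation.Binary.Construct.Closure.ReflexiveTransitive using (Star)
open import Relation.Binary.Construct.Closure.Transitive using (TransClosure)
open import Function.Bundles using (_⇔_)

Digraph : ℕ → Set
Digraph n = Fin n → Fin n → Bool

module _ {n : ℕ} where

  Edge : Digraph n → Fin n → Fin n → Set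
  Edge D u v = D u v ≡ true

  Subgraph : Digraph n → Digraph n → Set
  Subgraph T D = ∀ u v → Edge T u v → Edge D u v

  _≤[_]_ : Fin n → Digraph n → Fin n → Set
  v ≤[ T ] w = Star (Edge T) v w

  record IsArborescence (T : Digraph n) (r : Fin n) : Set where
    field
      root-indeg0 : ∀ u → ¬ Edge T u r
      indeg1      : ∀ v → v ≢ r → ∃[ u ] Edge T u v
      indeg≤1     : ∀ u u' v → Edge T u v → Edge T u' v → u ≡ u'
      reach       : ∀ v → r ≤[ T ] v

  SpanningArborescence : Digraph n → Digraph n → Fin n → Set
  SpanningArborescence D T r = Subgraph T D × IsArborescence T r

  data Walk (D : Digraph n) : Fin n → List (Fin n) → Fin n → Set where
    step : ∀ {x y} → Edge D x y → Walk D x [] y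
    _∷_  : ∀ {x y z is} → Edge D x y → Walk D y is z → Walk D x (y ∷ is) z

  -- A T-path from x to y (V(T) = all vertices, as T is spanning):
  -- a non-trivial directed path x, is..., y in D (all vertices distinct)
  -- whose interior vertices `is` avoid V(T).
  -- `InT` is the vertex set of T.
  record TPath (D : Digraph n) (InT : Fin n → Set) (x y : Fin n) : Set where
    field
      interior : List (Fin n)
      walk     : Walk D x interior y
      distinct : Unique (x ∷ y ∷ interior)
      avoids   : All (λ z → ¬ InT z) interior

  -- vertex set of a spanning arborescence: all of Fin n
  AllVertices : Fin n → Set
  AllVertices _ = Fin n

  Incomparable : Digraph n → Fin n → Fin n → Set
  Incomparable T v w = ¬ (v ≤[ T ] w) × ¬ (w ≤[ T ] v)

  data NormalAssistant (D T : Digraph n) : Fin n → Fin n → Set where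
    tree  : ∀ {v w} → Edge T v w → NormalAssistant D T v w
    extra : ∀ {v w} → Incomparable T v w →
            (∃[ a ] ∃[ b ] (v ≤[ T ] a × w ≤[ T ] b × TPath D AllVertices a b)) →
            NormalAssistant D T v w

  Acyclic : (Fin n → Fin n → Set) → Set
  Acyclic R = ∀ v → ¬ TransClosure R v v

  Normal : Digraph n → Digraph n → Set
  Normal D T = Acyclic (NormalAssistant D T)

  -- Depth-first search, as a nondeterministic transition system.
  -- stack   : the current vertex followed by the vertices from which it
  --           was reached (head = current vertex x; next = vertex to
  --           backtrack to)
  -- visited : vertices visited so far
  -- treeEdges : edges along which new vertices were first reached
  record DFSState : Set where
    constructor ⟨_,_,_⟩
    field
      stack   : List (Fin n)
      visited : List (Fin n)
      treeEdges : List (Fin n × Fin n)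

  data DFSStep (D : Digraph n) : DFSState → DFSState → Set where
    advance : ∀ {x s vis es y} → Edge D x y → y ∉ vis →
              DFSStep D ⟨ x ∷ s , vis , es ⟩ ⟨ y ∷ x ∷ s , y ∷ vis , (x , y) ∷ es ⟩
    backtrack : ∀ {x s vis es} → (∀ y → Edge D x y → y ∈ vis) →
              DFSStep D ⟨ x ∷ s , vis , es ⟩ ⟨ s , vis , es ⟩

  DFSRun : Digraph n → Fin n → List (Fin n × Fin n) → Set
  DFSRun D r es = ∃[ vis ] Star (DFSStep D) ⟨ r ∷ [] , r ∷ [] , [] ⟩ ⟨ [] , vis , es ⟩

  IsDFSTree : Digraph n → Digraph n → Set
  IsDFSTree D T = ∃[ r ] ∃[ es ] (DFSRun D r es × (∀ u v → Edge T u v ⇔ ((u , v) ∈ es)))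

{-# OPTIONS --safe #-}
module Submission where

-- A DFS tree is normal: number the vertices by finishing time. A tree child finishes
-- before its parent, and when v finishes, every vertex w incomparable to v whose subtree
-- receives an edge from the subtree of v has already been visited, and, not being on the
-- stack, finished. So every edge of the normal assistant decreases the finishing time.
--
-- Conversely, let T be normal and run DFS along T: at x, descend into an unvisited child
-- y that is a sink of the relation "some D-edge goes from the subtree of a into that of b"
-- on x's unvisited children; a sink exists as this relation lies in the acyclic normal
-- assistant. With this rule every D-edge leaving the current subtree ends at a visited
-- vertex, so backtracking is legal exactly when T says so, and the run builds T.

open import Defs
open import Data.Bool using (true)
import Data.Bool.Properties as Bool
open import Data.Empty using (⊥-elim)
open import Data.Fin using (Fin)
open import Data.Fin.Properties using (_≟_; any?)
open import Data.List using (List; []; _∷_; length; filter; allFin)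
open import Data.List.Properties using (filter-notAll)
import Data.List.Membership.DecPropositional as DecMembership
open import Data.List.Membership.Propositional using (_∈_; _∉_; find; lose)
open import Data.List.Membership.Propositional.Properties using (∈-filter⁺; ∈-allFin)
open import Data.List.Relation.Binary.Subset.Propositional using (_⊆_)
open import Data.List.Relation.Binary.Subset.Propositional.Properties using (∷⁺ʳ)
open import Data.List.Relation.Unary.All using ([]; _∷_)
open import Data.List.Relation.Unary.AllPairs using ([]; _∷_)
import Data.List.Relation.Unary.Any as Any
open import Data.List.Relation.Unary.Any using (here; there)
open import Data.Nat using (ℕ; suc; _+_; _≤_; _<_; s≤s⁻¹)
open import Data.Nat.Induction using (<-wellFounded)
open import Data.Nat.Properties
  using (≤-refl; ≤-trans; ≤-reflexive; <⇒≤; <-irrefl; <-trans; <-≤-trans; <⇒≱; n<1+n; m<n⇒m<1+n;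
         +-mono-≤; +-monoˡ-≤; +-monoʳ-<; module ≤-Reasoning)
open import Data.Nat.Tactic.RingSolver using (solve-∀)
open import Data.Product using (∃-syntax; _×_; _,_; proj₁; proj₂; map₁)
open import Data.Sum using (_⊎_; inj₁; inj₂; [_,_]′)
open import Data.Unit using (⊤; tt)
open import Data.Vec.Functional using (updateAt)
open import Data.Vec.Functional.Properties using (updateAt-updates; updateAt-minimal)
open import Function using (_∘_)
open import Function.Bundles using (_⇔_; mk⇔; Equivalence)
open import Induction.WellFounded using (Acc; acc)
open import Relation.Binary.Definitions using (Decidable)
open import Relation.Binary.PropositionalEquality using (_≡_; _≢_; refl; sym; trans; subst; subst₂; cong)
open import Relation.Binary.Construct.Closure.ReflexiveTransitive using (Star; ε; _◅_; _◅◅_)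
open import Relation.Binary.Construct.Closure.Transitive using (TransClosure; [_]; _∷_)
open import Relation.Nullary using (¬_; Dec; yes; no; ¬?)
open import Relation.Nullary.Decidable using (_×-dec_)

_without_ : ∀ {n} → List (Fin n) → Fin n → List (Fin n)
L without x = filter (λ z → ¬? (z ≟ x)) L

without-shorter : ∀ {n} {x : Fin n} {L} → x ∈ L → length (L without x) < length L
without-shorter {L = L} x∈L = filter-notAll _ L (lose x∈L (λ x≢x → x≢x refl))

∈-without : ∀ {n} {x z : Fin n} {L} → z ∈ L → z ≢ x → z ∈ L without x
∈-without = ∈-filter⁺ _

module _ {n : ℕ} {R : Fin n → Fin n → Set} where

  ranked⇒acyclic : (rank : Fin n → ℕ) → (∀ {v w} → R v w → rank w < rank v) → Acyclic R
  ranked⇒acyclic rank descends v = <-irrefl refl ∘ descends⁺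
    where
    descends⁺ : ∀ {v w} → TransClosure R v w → rank w < rank v
    descends⁺ [ e ]    = descends e
    descends⁺ (e ∷ es) = <-trans (descends⁺ es) (descends e)

  acyclic-⊆ : {R′ : Fin n → Fin n → Set} → (∀ {v w} → R v w → R′ v w) → Acyclic R′ → Acyclic R
  acyclic-⊆ {R′} R⊆R′ acyclic v = acyclic v ∘ lift
    where
    lift : ∀ {v w} → TransClosure R v w → TransClosure R′ v w
    lift [ e ]    = [ R⊆R′ e ]
    lift (e ∷ es) = R⊆R′ e ∷ lift es

  module _ (R? : Decidable R) (acyclic : Acyclic R) where

    private
      star⁺ : ∀ {a b c} → R a b → Star R b c → TransClosure R a c
      star⁺ e ε        = [ e ]
      star⁺ e (e′ ◅ es) = e ∷ star⁺ e′ es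

      sink-within : ∀ k (L : List (Fin n)) → length L < k → ∀ {x} → x ∈ L →
                    ∃[ y ] (Star R x y × ∀ {t} → t ∈ L → ¬ R y t)
      sink-within (suc k) L |L|<1+k {x} x∈L with Any.any? (R? x) L
      ... | no no-successor = x , ε , λ t∈L → no-successor ∘ lose t∈L
      ... | yes successor with find successor
      ... | t , t∈L , x→t
        with sink-within k (L without x) (<-≤-trans (without-shorter x∈L) (s≤s⁻¹ |L|<1+k))
               (∈-without t∈L λ t≡x → acyclic x [ subst (R x) t≡x x→t ])
      ... | y , t→*y , y-sink = y , x→t ◅ t→*y , y-sink′
        where
        y-sink′ : ∀ {t′} → t′ ∈ L → ¬ R y t′
        y-sink′ {t′} t′∈L y→t′ with t′ ≟ x
        ... | yes refl = acyclic x (star⁺ x→t (t→*y ◅◅ (y→t′ ◅ ε)))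
        ... | no t′≢x  = y-sink (∈-without t′∈L t′≢x) y→t′

    reaches-sink : ∀ x → ∃[ y ] (Star R x y × ∀ t → ¬ R y t)
    reaches-sink x with sink-within _ (allFin n) (n<1+n _) (∈-allFin x)
    ... | y , x→*y , y-sink = y , x→*y , λ t → y-sink (∈-allFin t)

-- The paper's T-paths from ⌊v⌋ to ⌊w⌋: as T spans D, these are single non-loop edges of D.
TPath⇒Edge : ∀ {n} {D : Digraph n} {a b} → TPath D AllVertices a b → Edge D a b × a ≢ b
TPath⇒Edge record { interior = [] ; walk = step e ; distinct = (a≢b ∷ []) ∷ _ } = e , a≢b
TPath⇒Edge record { interior = z ∷ _ ; avoids = z∉T ∷ _ } = ⊥-elim (z∉T z)

SubtreeEdge : ∀ {n} → Digraph n → Digraph n → Fin n → Fin n → Set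
SubtreeEdge D T v w = ∃[ a ] ∃[ b ] (v ≤[ T ] a × w ≤[ T ] b × Edge D a b × a ≢ b)

module _ {n} {D T : Digraph n} {v w : Fin n} where

  subtreeTPath⇒SubtreeEdge : ∃[ a ] ∃[ b ] (v ≤[ T ] a × w ≤[ T ] b × TPath D AllVertices a b) →
                             SubtreeEdge D T v w
  subtreeTPath⇒SubtreeEdge (a , b , v≤a , w≤b , p) = a , b , v≤a , w≤b , TPath⇒Edge p

  incomparable-SubtreeEdge⇒assistant : Incomparable T v w → SubtreeEdge D T v w → NormalAssistant D T v w
  incomparable-SubtreeEdge⇒assistant inc (a , b , v≤a , w≤b , e , a≢b) =
    extra inc (a , b , v≤a , w≤b , p)
    where
    p : TPath D AllVertices a b
    p = record { interior = [] ; walk = step e ; distinct = (a≢b ∷ []) ∷ ([] ∷ []) ; avoids = [] }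

module Arborescence {n : ℕ} {T : Digraph n} {r : Fin n} (A : IsArborescence T r) where
  open IsArborescence A public

  infix 4 _≤T_ _≤T?_

  _≤T_ : Fin n → Fin n → Set
  u ≤T v = u ≤[ T ] v

  data RootPath : Fin n → Set where
    root : RootPath r
    _▸_  : ∀ {u v} → RootPath u → Edge T u v → RootPath v

  extend : ∀ {u v} → RootPath u → u ≤T v → RootPath v
  extend p ε       = p
  extend p (e ◅ q) = extend (p ▸ e) q

  rootPath : ∀ v → RootPath v
  rootPath v = extend root (reach v)

  pathLength : ∀ {v} → RootPath v → ℕ
  pathLength root    = 0
  pathLength (p ▸ _) = suc (pathLength p)

  pathLength-unique : ∀ {v} (p q : RootPath v) → pathLength p ≡ pathLength q
  pathLength-unique root     root      = refl
  pathLength-unique root     (_ ▸ e)   = ⊥-elim (root-indeg0 _ e)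
  pathLength-unique (_ ▸ e)  root      = ⊥-elim (root-indeg0 _ e)
  pathLength-unique (p ▸ e)  (q ▸ e′)  with indeg≤1 _ _ _ e e′
  ... | refl = cong suc (pathLength-unique p q)

  depth : Fin n → ℕ
  depth v = pathLength (rootPath v)

  depth-edge : ∀ {u v} → Edge T u v → depth v ≡ suc (depth u)
  depth-edge {u} {v} e = pathLength-unique (rootPath v) (rootPath u ▸ e)

  depth-< : ∀ {u v} → Edge T u v → depth u < depth v
  depth-< e = ≤-reflexive (sym (depth-edge e))

  depth-siblings : ∀ {z v w} → Edge T z v → Edge T z w → depth v ≡ depth w
  depth-siblings e e′ = trans (depth-edge e) (sym (depth-edge e′))

  depth-mono : ∀ {u v} → u ≤T v → depth u ≤ depth v
  depth-mono ε       = ≤-refl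
  depth-mono (e ◅ q) = ≤-trans (<⇒≤ (depth-< e)) (depth-mono q)

  ≤T∧depth≡⇒≡ : ∀ {u v} → u ≤T v → depth u ≡ depth v → u ≡ v
  ≤T∧depth≡⇒≡ ε       _  = refl
  ≤T∧depth≡⇒≡ (e ◅ q) eq = ⊥-elim (<-irrefl eq (<-≤-trans (depth-< e) (depth-mono q)))

  child≰parent : ∀ {u c} → Edge T u c → ¬ c ≤T u
  child≰parent e q = <⇒≱ (depth-< e) (depth-mono q)

  ≤T-last : ∀ {u y} → u ≤T y → u ≡ y ⊎ ∃[ p ] (Edge T p y × u ≤T p)
  ≤T-last ε = inj₁ refl
  ≤T-last (e ◅ q) with ≤T-last q
  ... | inj₁ refl           = inj₂ (_ , e , ε)
  ... | inj₂ (p , e′ , q′)  = inj₂ (p , e′ , e ◅ q′)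

  ≤T-root : ∀ {u} → u ≤T r → u ≡ r
  ≤T-root q with ≤T-last q
  ... | inj₁ u≡r         = u≡r
  ... | inj₂ (p , e , _) = ⊥-elim (root-indeg0 p e)

  ≤T-child : ∀ {u x y} → Edge T x y → u ≤T y → u ≡ y ⊎ u ≤T x
  ≤T-child e q with ≤T-last q
  ... | inj₁ u≡y = inj₁ u≡y
  ... | inj₂ (p , e′ , q′) with indeg≤1 p _ _ e′ e
  ... | refl = inj₂ q′

  ≤T-decidable-along : ∀ u {v} → RootPath v → Dec (u ≤T v)
  ≤T-decidable-along u root with u ≟ r
  ... | yes refl = yes ε
  ... | no u≢r   = no (u≢r ∘ ≤T-root)
  ≤T-decidable-along u (_▸_ {v = v} p e) with u ≟ v
  ... | yes refl = yes ε
  ... | no u≢v with ≤T-decidable-along u p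
  ...   | yes q = yes (q ◅◅ (e ◅ ε))
  ...   | no ¬q = no ([ u≢v , ¬q ]′ ∘ ≤T-child e)

  _≤T?_ : Decidable _≤T_
  u ≤T? v = ≤T-decidable-along u (rootPath v)

  ≤T-total-along : ∀ {x u u′} → RootPath x → u ≤T x → u′ ≤T x → u ≤T u′ ⊎ u′ ≤T u
  ≤T-total-along root q q′ with ≤T-root q | ≤T-root q′
  ... | refl | refl = inj₁ ε
  ≤T-total-along (p ▸ e) q q′ with ≤T-child e q | ≤T-child e q′
  ... | inj₁ refl | _         = inj₂ q′
  ... | inj₂ _    | inj₁ refl = inj₁ q
  ... | inj₂ a    | inj₂ b    = ≤T-total-along p a b

  ≤T-total-below : ∀ {x u u′} → u ≤T x → u′ ≤T x → u ≤T u′ ⊎ u′ ≤T u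
  ≤T-total-below {x} = ≤T-total-along (rootPath x)

  siblings-≡ : ∀ {z v w x} → Edge T z v → Edge T z w → v ≤T x → w ≤T x → v ≡ w
  siblings-≡ e e′ q q′ with ≤T-total-below q q′
  ... | inj₁ v≤w = ≤T∧depth≡⇒≡ v≤w (depth-siblings e e′)
  ... | inj₂ w≤v = sym (≤T∧depth≡⇒≡ w≤v (depth-siblings e′ e))

  siblings-incomparable : ∀ {z v w} → Edge T z v → Edge T z w → v ≢ w → Incomparable T v w
  siblings-incomparable e e′ v≢w =
    (λ v≤w → v≢w (≤T∧depth≡⇒≡ v≤w (depth-siblings e e′))) ,
    (λ w≤v → v≢w (sym (≤T∧depth≡⇒≡ w≤v (depth-siblings e′ e))))

  subtreeEdge? : (D : Digraph n) → Decidable (SubtreeEdge D T)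
  subtreeEdge? D v w = any? λ a → any? λ b →
    v ≤T? a ×-dec w ≤T? b ×-dec D a b Bool.≟ true ×-dec ¬? (a ≟ b)

  data Stack (P : Fin n → Fin n → Set) (b : Fin n) : List (Fin n) → Set where
    empty  : Stack P b []
    bottom : Stack P b (b ∷ [])
    push   : ∀ {x y s} → Edge T x y → P x y → Stack P b (x ∷ s) → Stack P b (y ∷ x ∷ s)

  module _ {P : Fin n → Fin n → Set} where

    pop : ∀ {b x s} → Stack P b (x ∷ s) → Stack P b s
    pop bottom         = empty
    pop (push _ _ st)  = st

    map-Stack : ∀ {Q : Fin n → Fin n → Set} {b s} →
                (∀ {x y} → P x y → Q x y) → Stack P b s → Stack Q b s
    map-Stack f empty           = empty
    map-Stack f bottom          = bottom
    map-Stack f (push e p st)   = push e (f p) (map-Stack f st)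

    Stack-≤top : ∀ {b x s u} → Stack P b (x ∷ s) → u ∈ x ∷ s → u ≤T x
    Stack-≤top _              (here refl) = ε
    Stack-≤top (push e _ st)  (there u∈s) = Stack-≤top st u∈s ◅◅ (e ◅ ε)

    Stack-ancestor : ∀ {x s u} → Stack P r (x ∷ s) → u ≤T x → u ∈ x ∷ s
    Stack-ancestor bottom q = here (≤T-root q)
    Stack-ancestor (push e _ st) q with ≤T-child e q
    ... | inj₁ u≡x = here u≡x
    ... | inj₂ q′  = there (Stack-ancestor st q′)

    Stack-branch : ∀ {x s y} → Stack P r (x ∷ s) → ¬ x ≤T y →
                   ∃[ z ] ∃[ v ] (Edge T z v × P z v × z ≤T y × ¬ v ≤T y × v ≤T x)
    Stack-branch {y = y} bottom x≰y = ⊥-elim (x≰y (reach y))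
    Stack-branch {y = y} (push {x} {x′} e p st) x′≰y with x ≤T? y
    ... | yes x≤y = x , x′ , e , p , x≤y , x′≰y , ε
    ... | no  x≰y with Stack-branch st x≰y
    ... | z , v , e′ , p′ , z≤y , v≰y , v≤x = z , v , e′ , p′ , z≤y , v≰y , v≤x ◅◅ (e ◅ ε)

Finished : ∀ {n} → List (Fin n) → List (Fin n) → Fin n → Set
Finished S V z = z ∈ V × z ∉ S

finished-push⁻ : ∀ {n} {S V : List (Fin n)} {y z} → Finished (y ∷ S) (y ∷ V) z → Finished S V z
finished-push⁻ (here z≡y , z∉) = ⊥-elim (z∉ (here z≡y))
finished-push⁻ (there z∈V , z∉) = z∈V , z∉ ∘ there

finished-push⁺ : ∀ {n} {S V : List (Fin n)} {y z} → y ∉ V → Finished S V z →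
                 Finished (y ∷ S) (y ∷ V) z
finished-push⁺ y∉V (z∈V , z∉S) = there z∈V , λ { (here refl) → y∉V z∈V ; (there z∈S) → z∉S z∈S }

finished-pop⁺ : ∀ {n} {s V : List (Fin n)} {x z} → Finished (x ∷ s) V z → Finished s V z
finished-pop⁺ (z∈V , z∉) = z∈V , z∉ ∘ there

finished-pop⁻ : ∀ {n} {s V : List (Fin n)} {x z} → Finished s V z → z ≡ x ⊎ Finished (x ∷ s) V z
finished-pop⁻ {x = x} {z} (z∈V , z∉s) with z ≟ x
... | yes z≡x = inj₁ z≡x
... | no  z≢x = inj₂ (z∈V , λ { (here z≡x) → z≢x z≡x ; (there z∈s) → z∉s z∈s })

module DFSRuns {n : ℕ} {D : Digraph n} where
  open DFSState

  treeEdges-mono : ∀ {st st′} → Star (DFSStep D) st st′ → treeEdges st ⊆ treeEdges st′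
  treeEdges-mono ε                     = λ m → m
  treeEdges-mono (advance _ _ ◅ run)   = treeEdges-mono run ∘ there
  treeEdges-mono (backtrack _ ◅ run)   = treeEdges-mono run

  record Grounded (r₀ : Fin n) (st : DFSState) : Set where
    field
      root-visited  : r₀ ∈ visited st
      heads-visited : ∀ {u c} → (u , c) ∈ treeEdges st → c ∈ visited st
      root-not-head : ∀ {u c} → (u , c) ∈ treeEdges st → c ≢ r₀

  grounded-initial : ∀ {r₀} → Grounded r₀ ⟨ r₀ ∷ [] , r₀ ∷ [] , [] ⟩
  grounded-initial = record { root-visited = here refl ; heads-visited = λ () ; root-not-head = λ () }

  grounded-step : ∀ {r₀ st st′} → DFSStep D st st′ → Grounded r₀ st → Grounded r₀ st′
  grounded-step (backtrack _) g = record { Grounded g }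
  grounded-step (advance _ y∉vis) g = record
    { root-visited  = there root-visited
    ; heads-visited = λ { (here refl) → here refl ; (there m) → there (heads-visited m) }
    ; root-not-head = λ { (here refl) refl → y∉vis root-visited ; (there m) → root-not-head m }
    }
    where open Grounded g

  grounded-run : ∀ {r₀ st st′} → Star (DFSStep D) st st′ → Grounded r₀ st → Grounded r₀ st′
  grounded-run ε           g = g
  grounded-run (s ◅ run)   g = grounded-run run (grounded-step s g)

module DFSTreeIsNormal {n : ℕ} {D T : Digraph n} {r : Fin n} (T⊆D : Subgraph T D) (A : IsArborescence T r) where
  open Arborescence A
  open DFSRuns {D = D}

  -- τ is the next finishing time to hand out; f is meaningful on finished vertices only.
  record FinishingTimes (r₀ : Fin n) (S V : List (Fin n)) (τ : ℕ) (f : Fin n → ℕ) : Set where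
    field
      stack-visited    : S ⊆ V
      stack            : Stack (λ _ _ → ⊤) r₀ S
      finished-closed  : ∀ {z y} → Finished S V z → Edge D z y → y ∈ V
      parent-visited   : ∀ {u y} → y ∈ V → Edge T u y → u ∈ V
      finished-before  : ∀ {z} → Finished S V z → f z < τ
      tree-descending  : ∀ {u c} → Finished S V u → Edge T u c → Finished S V c × f c < f u
      cross-descending : ∀ {v w} → Finished S V v → Incomparable T v w → SubtreeEdge D T v w →
                         Finished S V w × f w < f v

  module _ {r₀ S V τ f} (I : FinishingTimes r₀ S V τ f) where
    open FinishingTimes I

    descendant-finished : ∀ {c a} → Finished S V c → c ≤T a → Finished S V a
    descendant-finished c-fin ε       = c-fin
    descendant-finished c-fin (e ◅ q) = descendant-finished (proj₁ (tree-descending c-fin e)) q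

    ancestor-visited : ∀ {w b} → w ≤T b → b ∈ V → w ∈ V
    ancestor-visited ε       b∈V = b∈V
    ancestor-visited (e ◅ q) b∈V = parent-visited (ancestor-visited q b∈V) e

  pushed : ∀ {r₀ x y s V τ f} → Edge T x y → y ∉ V →
           FinishingTimes r₀ (x ∷ s) V τ f → FinishingTimes r₀ (y ∷ x ∷ s) (y ∷ V) τ f
  pushed {y = y} {V = V} e y∉V I = record
    { stack-visited    = ∷⁺ʳ y stack-visited
    ; stack            = push e tt stack
    ; finished-closed  = λ z-fin → there ∘ finished-closed (finished-push⁻ z-fin)
    ; parent-visited   = parent-visited′
    ; finished-before  = finished-before ∘ finished-push⁻
    ; tree-descending  = λ u-fin e′ →
        map₁ (finished-push⁺ y∉V) (tree-descending (finished-push⁻ u-fin) e′)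
    ; cross-descending = λ v-fin inc se →
        map₁ (finished-push⁺ y∉V) (cross-descending (finished-push⁻ v-fin) inc se)
    }
    where
    open FinishingTimes I
    parent-visited′ : ∀ {u c} → c ∈ y ∷ V → Edge T u c → u ∈ y ∷ V
    parent-visited′ (here refl) e′ with indeg≤1 _ _ _ e′ e
    ... | refl = there (stack-visited (here refl))
    parent-visited′ (there c∈V) e′ = there (parent-visited c∈V e′)

  module Backtrack {r₀ x s V τ f} (x-done : ∀ y → Edge D x y → y ∈ V)
                   (I : FinishingTimes r₀ (x ∷ s) V τ f) where
    open FinishingTimes I

    f′ : Fin n → ℕ
    f′ = updateAt f x (λ _ → τ)

    f′-x : f′ x ≡ τ
    f′-x = updateAt-updates x f

    f′-old : ∀ {z} → Finished (x ∷ s) V z → f′ z ≡ f z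
    f′-old (_ , z∉) = updateAt-minimal _ x f (z∉ ∘ here)

    below-x : ∀ {w} → Finished (x ∷ s) V w → Finished s V w × f′ w < f′ x
    below-x w-fin =
      finished-pop⁺ w-fin , subst₂ _<_ (sym (f′-old w-fin)) (sym f′-x) (finished-before w-fin)

    below-old : ∀ {v w} → Finished (x ∷ s) V v → Finished (x ∷ s) V w × f w < f v →
                Finished s V w × f′ w < f′ v
    below-old v-fin (w-fin , lt) =
      finished-pop⁺ w-fin , subst₂ _<_ (sym (f′-old w-fin)) (sym (f′-old v-fin)) lt

    off-stack : ∀ {w} → ¬ w ≤T x → w ∉ x ∷ s
    off-stack w≰x = w≰x ∘ Stack-≤top stack

    child-finished : ∀ {c} → Edge T x c → Finished (x ∷ s) V c
    child-finished e = x-done _ (T⊆D _ _ e) , off-stack (child≰parent e)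

    subtree-successor-visited : ∀ {a b} → x ≤T a → Edge D a b → b ∈ V
    subtree-successor-visited ε       d = x-done _ d
    subtree-successor-visited (e ◅ q) d = finished-closed (descendant-finished I (child-finished e) q) d

    cross-from-x : ∀ {w} → Incomparable T x w → SubtreeEdge D T x w → Finished (x ∷ s) V w
    cross-from-x (_ , w≰x) (_ , _ , x≤a , w≤b , d , _) =
      ancestor-visited I w≤b (subtree-successor-visited x≤a d) , off-stack w≰x

    popped : FinishingTimes r₀ s V (suc τ) f′
    popped = record
      { stack-visited    = stack-visited ∘ there
      ; stack            = pop stack
      ; finished-closed  = finished-closed′
      ; parent-visited   = parent-visited
      ; finished-before  = finished-before′
      ; tree-descending  = tree-descending′
      ; cross-descending = cross-descending′
      }
      where
      finished-closed′ : ∀ {z y} → Finished s V z → Edge D z y → y ∈ V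
      finished-closed′ z-fin with finished-pop⁻ {x = x} z-fin
      ... | inj₁ refl  = x-done _
      ... | inj₂ z-fin′ = finished-closed z-fin′

      finished-before′ : ∀ {z} → Finished s V z → f′ z < suc τ
      finished-before′ z-fin with finished-pop⁻ {x = x} z-fin
      ... | inj₁ refl  = ≤-reflexive (cong suc f′-x)
      ... | inj₂ z-fin′ = subst (_< suc τ) (sym (f′-old z-fin′)) (m<n⇒m<1+n (finished-before z-fin′))

      tree-descending′ : ∀ {u c} → Finished s V u → Edge T u c → Finished s V c × f′ c < f′ u
      tree-descending′ u-fin e with finished-pop⁻ {x = x} u-fin
      ... | inj₁ refl  = below-x (child-finished e)
      ... | inj₂ u-fin′ = below-old u-fin′ (tree-descending u-fin′ e)

      cross-descending′ : ∀ {v w} → Finished s V v → Incomparable T v w → SubtreeEdge D T v w →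
                          Finished s V w × f′ w < f′ v
      cross-descending′ v-fin inc se with finished-pop⁻ {x = x} v-fin
      ... | inj₁ refl  = below-x (cross-from-x inc se)
      ... | inj₂ v-fin′ = below-old v-fin′ (cross-descending v-fin′ inc se)

  times-run : ∀ {r₀ S V E Vf Ef τ f} → Star (DFSStep D) ⟨ S , V , E ⟩ ⟨ [] , Vf , Ef ⟩ →
              (∀ {u v} → (u , v) ∈ Ef → Edge T u v) →
              FinishingTimes r₀ S V τ f → ∃[ τ′ ] ∃[ f′ ] FinishingTimes r₀ [] Vf τ′ f′
  times-run ε _ I = _ , _ , I
  times-run (advance _ y∉V ◅ run) tree-edge I =
    times-run run tree-edge (pushed (tree-edge (treeEdges-mono run (here refl))) y∉V I)
  times-run (backtrack x-done ◅ run) tree-edge I = times-run run tree-edge (Backtrack.popped x-done I)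

  initial-times : ∀ {r₀} → (∀ {u} → ¬ Edge T u r₀) →
                  FinishingTimes r₀ (r₀ ∷ []) (r₀ ∷ []) 0 (λ _ → 0)
  initial-times {r₀} r₀-parentless = record
    { stack-visited    = λ m → m
    ; stack            = bottom
    ; finished-closed  = ⊥-elim ∘ nothing-finished
    ; parent-visited   = λ { (here refl) e → ⊥-elim (r₀-parentless e) }
    ; finished-before  = ⊥-elim ∘ nothing-finished
    ; tree-descending  = ⊥-elim ∘ nothing-finished
    ; cross-descending = ⊥-elim ∘ nothing-finished
    }
    where
    nothing-finished : ∀ {z} → ¬ Finished (r₀ ∷ []) (r₀ ∷ []) z
    nothing-finished (z∈ , z∉) = z∉ z∈

  run-spans : ∀ {r₀ Vf Ef} → Star (DFSStep D) ⟨ r₀ ∷ [] , r₀ ∷ [] , [] ⟩ ⟨ [] , Vf , Ef ⟩ →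
              (∀ u v → Edge T u v ⇔ ((u , v) ∈ Ef)) → (∀ {u} → ¬ Edge T u r₀) × (∀ v → v ∈ Vf)
  run-spans {r₀} {Vf} run T⇔Ef = r₀-parentless , all-visited
    where
    open Grounded (grounded-run run grounded-initial)

    r₀-parentless : ∀ {u} → ¬ Edge T u r₀
    r₀-parentless e = root-not-head (Equivalence.to (T⇔Ef _ _) e) refl

    r₀≡r : r₀ ≡ r
    r₀≡r with r₀ ≟ r
    ... | yes r₀≡r = r₀≡r
    ... | no  r₀≢r = ⊥-elim (r₀-parentless (proj₂ (indeg1 r₀ r₀≢r)))

    all-visited : ∀ v → v ∈ Vf
    all-visited v with v ≟ r
    ... | yes refl = subst (_∈ Vf) r₀≡r root-visited
    ... | no  v≢r  = heads-visited (Equivalence.to (T⇔Ef _ _) (proj₂ (indeg1 v v≢r)))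

  dfsTree⇒normal : IsDFSTree D T → Normal D T
  dfsTree⇒normal (r₀ , Ef , (Vf , run) , T⇔Ef) with run-spans run T⇔Ef
  ... | r₀-parentless , all-visited
    with times-run run (Equivalence.from (T⇔Ef _ _)) (initial-times r₀-parentless)
  ... | _ , f , I = ranked⇒acyclic f descending
    where
    open FinishingTimes I

    finished : ∀ v → Finished [] Vf v
    finished v = all-visited v , λ ()

    descending : ∀ {v w} → NormalAssistant D T v w → f w < f v
    descending (tree e)           = proj₂ (tree-descending (finished _) e)
    descending (extra inc pathed) =
      proj₂ (cross-descending (finished _) inc (subtreeTPath⇒SubtreeEdge pathed))

module NormalTreeIsDFSTree {n : ℕ} {D T : Digraph n} {r : Fin n}
                           (T⊆D : Subgraph T D) (A : IsArborescence T r) (normal : Normal D T) where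
  open Arborescence A
  open DFSRuns {D = D}
  open DecMembership (_≟_ {n}) using (_∈?_)

  -- The rule under which the run descends from x to its child y.
  Chosen : List (Fin n) → Fin n → Fin n → Set
  Chosen V x y = ∀ {w} → Edge T x w → w ≢ y → SubtreeEdge D T y w → w ∈ V

  chosen-∷ : ∀ {V x y z} → Chosen V x y → Chosen (z ∷ V) x y
  chosen-∷ chosen x→w w≢y se = there (chosen x→w w≢y se)

  record Invariant (S V : List (Fin n)) (E : List (Fin n × Fin n)) : Set where
    field
      stack               : Stack (Chosen V) r S
      stack-visited       : S ⊆ V
      finished-subtree    : ∀ {u y} → Finished S V u → u ≤T y → y ∈ V
      tree-edges-sound    : ∀ {u c} → (u , c) ∈ E → Edge T u c
      tree-edges-complete : ∀ {u c} → Edge T u c → c ∈ V → (u , c) ∈ E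

  module Backtrack {x s V E} (I : Invariant (x ∷ s) V E)
                   (children-visited : ∀ {c} → Edge T x c → c ∈ V) where
    open Invariant I

    subtree-visited : ∀ {y} → x ≤T y → y ∈ V
    subtree-visited ε       = stack-visited (here refl)
    subtree-visited (e ◅ q) = finished-subtree (children-visited e , child≰parent e ∘ Stack-≤top stack) q

    allowed : ∀ y → Edge D x y → y ∈ V
    allowed y x→y with y ≤T? x
    ... | yes y≤x = stack-visited (Stack-ancestor stack y≤x)
    ... | no  y≰x with x ≤T? y
    ...   | yes x≤y = subtree-visited x≤y
    ...   | no  x≰y with Stack-branch stack x≰y
    ...     | _ , _ , z→v , _ , ε , _ , v≤x = ⊥-elim (y≰x (z→v ◅ v≤x))
    ...     | _ , v , z→v , v-chosen , _◅_ {j = w} z→w w≤y , v≰y , v≤x =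
              finished-subtree (w∈V , w∉S) w≤y
      where
      -- the edge x → y leads from the subtree of the stack vertex v into that of its
      -- sibling w, so w had to be visited before v was chosen
      w≢v : w ≢ v
      w≢v refl = v≰y w≤y
      w∈V : w ∈ V
      w∈V = v-chosen z→w w≢v (x , y , v≤x , w≤y , x→y , λ { refl → y≰x ε })
      w∉S : w ∉ x ∷ s
      w∉S w∈S = w≢v (siblings-≡ z→w z→v (Stack-≤top stack w∈S) v≤x)

    popped : Invariant s V E
    popped = record
      { stack               = pop stack
      ; stack-visited       = stack-visited ∘ there
      ; finished-subtree    = finished-subtree′
      ; tree-edges-sound    = tree-edges-sound
      ; tree-edges-complete = tree-edges-complete
      }
      where
      finished-subtree′ : ∀ {u y} → Finished s V u → u ≤T y → y ∈ V
      finished-subtree′ u-fin with finished-pop⁻ {x = x} u-fin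
      ... | inj₁ refl   = subtree-visited
      ... | inj₂ u-fin′ = finished-subtree u-fin′

  UnvisitedSiblingEdge : Fin n → List (Fin n) → Fin n → Fin n → Set
  UnvisitedSiblingEdge x V a b = Edge T x a × Edge T x b × a ≢ b × b ∉ V × SubtreeEdge D T a b

  unvisitedSiblingEdge? : ∀ x V → Decidable (UnvisitedSiblingEdge x V)
  unvisitedSiblingEdge? x V a b =
    T x a Bool.≟ true ×-dec T x b Bool.≟ true ×-dec ¬? (a ≟ b) ×-dec ¬? (b ∈? V) ×-dec subtreeEdge? D a b

  unvisitedSiblingEdge-acyclic : ∀ x V → Acyclic (UnvisitedSiblingEdge x V)
  unvisitedSiblingEdge-acyclic x V = acyclic-⊆ in-assistant normal
    where
    in-assistant : ∀ {a b} → UnvisitedSiblingEdge x V a b → NormalAssistant D T a b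
    in-assistant (x→a , x→b , a≢b , _ , se) =
      incomparable-SubtreeEdge⇒assistant (siblings-incomparable x→a x→b a≢b) se

  unvisited-child-along : ∀ {x V c y} → Star (UnvisitedSiblingEdge x V) c y →
                          Edge T x c → c ∉ V → Edge T x y × y ∉ V
  unvisited-child-along ε                           x→c c∉V = x→c , c∉V
  unvisited-child-along ((_ , x→b , _ , b∉V , _) ◅ q) _   _   = unvisited-child-along q x→b b∉V

  choose-child : ∀ {x V c} → Edge T x c → c ∉ V → ∃[ y ] (Edge T x y × y ∉ V × Chosen V x y)
  choose-child {x} {V} {c} x→c c∉V
    with reaches-sink (unvisitedSiblingEdge? x V) (unvisitedSiblingEdge-acyclic x V) c
  ... | y , c→*y , y-sink with unvisited-child-along c→*y x→c c∉V
  ... | x→y , y∉V = y , x→y , y∉V , chosen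
    where
    chosen : Chosen V x y
    chosen {w} x→w w≢y se with w ∈? V
    ... | yes w∈V = w∈V
    ... | no  w∉V = ⊥-elim (y-sink w (x→y , x→w , w≢y ∘ sym , w∉V , se))

  pushed : ∀ {x y s V E} → Edge T x y → Chosen V x y → Invariant (x ∷ s) V E →
           Invariant (y ∷ x ∷ s) (y ∷ V) ((x , y) ∷ E)
  pushed {x} {y} {V = V} {E} x→y y-chosen I = record
    { stack               = push x→y (chosen-∷ y-chosen) (map-Stack chosen-∷ stack)
    ; stack-visited       = ∷⁺ʳ y stack-visited
    ; finished-subtree    = λ u-fin → there ∘ finished-subtree (finished-push⁻ u-fin)
    ; tree-edges-sound    = λ { (here refl) → x→y ; (there m) → tree-edges-sound m }
    ; tree-edges-complete = tree-edges-complete′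
    }
    where
    open Invariant I
    tree-edges-complete′ : ∀ {u c} → Edge T u c → c ∈ y ∷ V → (u , c) ∈ (x , y) ∷ E
    tree-edges-complete′ u→c (here refl) with indeg≤1 _ _ _ u→c x→y
    ... | refl = here refl
    tree-edges-complete′ u→c (there c∈V) = there (tree-edges-complete u→c c∈V)

  Completes : DFSState → Set
  Completes st = ∃[ V ] ∃[ E ] (Star (DFSStep D) st ⟨ [] , V , E ⟩ × Invariant [] V E)

  prepend : ∀ {st st′} → DFSStep D st st′ → Completes st′ → Completes st
  prepend move (V , E , run , I) = V , E , move ◅ run , I

  measure : List (Fin n) → List (Fin n) → ℕ
  measure U S = length U + length U + length S

  measure-pop : ∀ U x (s : List (Fin n)) → measure U s < measure U (x ∷ s)
  measure-pop U x s = +-monoʳ-< (length U + length U) (n<1+n (length s))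

  measure-push : ∀ (U U′ : List (Fin n)) x y s → length U′ < length U →
                 measure U′ (y ∷ x ∷ s) < measure U (x ∷ s)
  measure-push U U′ x y s U′<U = begin-strict
    u′ + u′ + suc (suc k) ≡⟨ shift u′ k ⟩
    suc u′ + suc u′ + k   ≤⟨ +-monoˡ-≤ k (+-mono-≤ U′<U U′<U) ⟩
    u + u + k             <⟨ +-monoʳ-< (u + u) (n<1+n k) ⟩
    u + u + suc k         ∎
    where
    open ≤-Reasoning
    u u′ k : ℕ
    u = length U
    u′ = length U′
    k = length s
    shift : ∀ a b → a + a + suc (suc b) ≡ suc a + suc a + b
    shift = solve-∀

  explore : ∀ {S V E} → Invariant S V E → (U : List (Fin n)) → (∀ {z} → z ∉ V → z ∈ U) →
            Acc _<_ (measure U S) → Completes ⟨ S , V , E ⟩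
  explore {[]} I _ _ _ = _ , _ , ε , I
  explore {x ∷ s} {V} I U unvisited⊆U (acc smaller)
    with any? (λ c → T x c Bool.≟ true ×-dec ¬? (c ∈? V))
  ... | no no-unvisited-child =
    prepend (backtrack (Backtrack.allowed I children-visited))
            (explore (Backtrack.popped I children-visited) U unvisited⊆U (smaller (measure-pop U x s)))
    where
    children-visited : ∀ {c} → Edge T x c → c ∈ V
    children-visited {c} x→c with c ∈? V
    ... | yes c∈V = c∈V
    ... | no  c∉V = ⊥-elim (no-unvisited-child (c , x→c , c∉V))
  ... | yes (c , x→c , c∉V) with choose-child x→c c∉V
  ... | y , x→y , y∉V , y-chosen =
    prepend (advance (T⊆D x y x→y) y∉V)
            (explore (pushed x→y y-chosen I) (U without y) unvisited⊆U′
                     (smaller (measure-push U (U without y) x y s (without-shorter (unvisited⊆U y∉V)))))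
    where
    unvisited⊆U′ : ∀ {z} → z ∉ y ∷ V → z ∈ U without y
    unvisited⊆U′ z∉ = ∈-without (unvisited⊆U (z∉ ∘ there)) (z∉ ∘ here)

  initial-invariant : Invariant (r ∷ []) (r ∷ []) []
  initial-invariant = record
    { stack               = bottom
    ; stack-visited       = λ m → m
    ; finished-subtree    = λ (r∈ , r∉) → ⊥-elim (r∉ r∈)
    ; tree-edges-sound    = λ ()
    ; tree-edges-complete = λ { u→r (here refl) → ⊥-elim (root-indeg0 _ u→r) }
    }

  normal⇒dfsTree : IsDFSTree D T
  normal⇒dfsTree with explore initial-invariant (allFin n) (λ {z} _ → ∈-allFin z) (<-wellFounded _)
  ... | V , E , run , I = r , E , (V , run) , λ u v →
    mk⇔ (λ u→v → tree-edges-complete u→v (visited v)) tree-edges-sound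
    where
    open Invariant I
    r-visited : r ∈ V
    r-visited = Grounded.root-visited (grounded-run run grounded-initial)
    visited : ∀ v → v ∈ V
    visited v = finished-subtree (r-visited , λ ()) (reach v)

corollary3p3 : (n : ℕ) (D T : Digraph n) (r : Fin n) →
    SpanningArborescence D T r → (Normal D T ⇔ IsDFSTree D T)
corollary3p3 n D T r (T⊆D , A) =
  mk⇔ (NormalTreeIsDFSTree.normal⇒dfsTree T⊆D A) (DFSTreeIsNormal.dfsTree⇒normal T⊆D A)
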